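{- Let $m \geq 3$. Let $G$ be the graph with vertex set $\mathbb{Z}_m\times\mathbb{Z}_8$ whose edges are: all edges $\{(i,x),(i+1,x+6)\}$ for $i\in\mathbb{Z}_m$, $x\in\mathbb{Z}_8$; and, for every $i\in\mathbb{Z}_m$, the edges $\{(i,x),(i,y)\}$ for each pair $\{x,y\}\in I_2\cup I_7$, where $I_2=\{\{1,2\},\{3,4\},\{5,6\},\{7,0\}\}$ and $I_7=\{\{0,3\},\{1,6\},\{2,5\},\{4,7\}\}$. Then $G$ admits a $C_8$-factorization consisting of two $C_8$-factors.
   Context: A $C_k$-factor of a graph is a spanning subgraph each of whose components is a cycle of length $k$; a $C_k$-factorization is a partition of the edge set into $C_k$-factors. -}

module Defs where

open import Data.Nat using (ℕ; zero; suc; _+_)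
open import Data.Nat.DivMod using (_mod_)
open import Data.Fin using (Fin; toℕ; #_)
open import Data.Product using (Σ; ∃; ∃-syntax; _×_; _,_)
open import Data.Sum using (_⊎_)
open import Relation.Binary.PropositionalEquality using (_≡_)
open import Function.Definitions using (Injective)


addMod : ∀ {m} → Fin m → ℕ → Fin m
addMod {suc n} i k = (toℕ i + k) mod suc n

next : ∀ {k} → Fin k → Fin k
next j = addMod j 1

record Cycle (V : Set) (Adj : V → V → Set) (k : ℕ) : Set where
  field
    vtx      : Fin k → V
    distinct : Injective _≡_ _≡_ vtx
    adjacent : ∀ j → Adj (vtx j) (vtx (next j))

EdgeOfCycle : ∀ {V Adj k} → Cycle V Adj k → V → V → Set
EdgeOfCycle C u v =
  ∃[ j ] ((Cycle.vtx C j ≡ u × Cycle.vtx C (next j) ≡ v)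
         ⊎ (Cycle.vtx C j ≡ v × Cycle.vtx C (next j) ≡ u))

record CkFactor (V : Set) (Adj : V → V → Set) (k : ℕ) : Set where
  field
    numCycles : ℕ
    cycle     : Fin numCycles → Cycle V Adj k
    cover     : ∀ v → ∃[ t ] ∃[ j ] (Cycle.vtx (cycle t) j ≡ v)
    disjoint  : ∀ t t' j j' → Cycle.vtx (cycle t) j ≡ Cycle.vtx (cycle t') j'
                → t ≡ t'

EdgeOfFactor : ∀ {V Adj k} → CkFactor V Adj k → V → V → Set
EdgeOfFactor F u v = ∃[ t ] EdgeOfCycle (CkFactor.cycle F t) u v

-- A C_k-factorization with r factors: r C_k-factors partitioning the
-- edge set, i.e. every edge of the graph lies in exactly one factor
-- (factor edges are graph edges by construction).
record CkFactorization (V : Set) (Adj : V → V → Set) (k r : ℕ) : Set where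
  field
    factor    : Fin r → CkFactor V Adj k
    partition : ∀ u v → Adj u v →
                ∃[ s ] (EdgeOfFactor (factor s) u v
                        × (∀ s' → EdgeOfFactor (factor s') u v → s' ≡ s))

Vertex : ℕ → Set
Vertex m = Fin m × Fin 8

-- unordered pairs of I₂ ∪ I₇, listed in both orders
data I₂∪I₇ : Fin 8 → Fin 8 → Set where
  p12 : I₂∪I₇ (# 1) (# 2)
  p21 : I₂∪I₇ (# 2) (# 1)
  p34 : I₂∪I₇ (# 3) (# 4)
  p43 : I₂∪I₇ (# 4) (# 3)
  p56 : I₂∪I₇ (# 5) (# 6)
  p65 : I₂∪I₇ (# 6) (# 5)
  p70 : I₂∪I₇ (# 7) (# 0)
  p07 : I₂∪I₇ (# 0) (# 7)
  p03 : I₂∪I₇ (# 0) (# 3)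
  p30 : I₂∪I₇ (# 3) (# 0)
  p16 : I₂∪I₇ (# 1) (# 6)
  p61 : I₂∪I₇ (# 6) (# 1)
  p25 : I₂∪I₇ (# 2) (# 5)
  p52 : I₂∪I₇ (# 5) (# 2)
  p47 : I₂∪I₇ (# 4) (# 7)
  p74 : I₂∪I₇ (# 7) (# 4)

CrossEdge : ∀ {m} → Vertex m → Vertex m → Set
CrossEdge (i , x) (j , y) = j ≡ addMod i 1 × y ≡ addMod x 6

LayerEdge : ∀ {m} → Vertex m → Vertex m → Set
LayerEdge (i , x) (j , y) = i ≡ j × I₂∪I₇ x y

AdjG : ∀ m → Vertex m → Vertex m → Set
AdjG m u v = CrossEdge u v ⊎ CrossEdge v u ⊎ LayerEdge u v

-- Each factor consists of the m translates of one 8-cycle that zigzags between two consecutive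
-- layers ℤ_8 × {t} and ℤ_8 × {t + 1}: the t-th translate uses cross edges starting in layer t
-- and layer edges of both layers. Translates are vertex-disjoint and cover everything because
-- the cycle takes every value of the ℤ_8-coordinate exactly once. The two zigzag cycles project onto the
-- Hamiltonian cycles (0 6 5 7 4 2 1 3) and (0 2 5 3 4 6 1 7) of ℤ_8. These share no edge, so no
-- edge of G lies in both factors, and together they contain all eight pairs {x , x + 6} of cross
-- edges and all eight pairs of I₂ ∪ I₇, so every edge of G lies in one of them.
module Submission where

open import Defs
open import Data.Nat using (ℕ; suc; _+_; _≤_; _%_)
open import Data.Nat.DivMod using (%-distribˡ-+; m%n%n≡m%n; [m+n]%n≡m%n; m<n⇒m%n≡m)
open import Data.Nat.Properties using (+-assoc; +-comm)
open import Data.Fin using (Fin; toℕ)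
open import Data.Fin.Patterns
open import Data.Fin.Properties using (toℕ-injective; toℕ-fromℕ<; toℕ<n; all?; any?; _≟_)
open import Data.Bool using (Bool; true; false)
open import Data.Product using (∃-syntax; _×_; _,_; proj₁; proj₂)
open import Data.Sum using (_⊎_; inj₁; inj₂)
open import Data.Empty using (⊥-elim)
open import Function using (_∘_)
open import Function.Definitions using (Injective)
open import Relation.Nullary using (¬_; Dec)
open import Relation.Nullary.Decidable using (¬?; _×-dec_; _⊎-dec_; _→-dec_; from-yes)
open import Relation.Binary.Definitions using (DecidableEquality)
open import Relation.Binary.PropositionalEquality

module _ {n : ℕ} where

  toℕ-addMod : (i : Fin (suc n)) (a : ℕ) → toℕ (addMod i a) ≡ (toℕ i + a) % suc n
  toℕ-addMod i a = toℕ-fromℕ< _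

  addMod-addMod : (i : Fin (suc n)) (a b : ℕ) → addMod (addMod i a) b ≡ addMod i (a + b)
  addMod-addMod i a b = toℕ-injective (begin
    toℕ (addMod (addMod i a) b)        ≡⟨ toℕ-addMod (addMod i a) b ⟩
    (toℕ (addMod i a) + b) % suc n     ≡⟨ cong (λ r → (r + b) % suc n) (toℕ-addMod i a) ⟩
    ((toℕ i + a) % suc n + b) % suc n  ≡⟨ [m%n+k]%n≡[m+k]%n (toℕ i + a) ⟩
    (toℕ i + a + b) % suc n            ≡⟨ cong (_% suc n) (+-assoc (toℕ i) a b) ⟩
    (toℕ i + (a + b)) % suc n          ≡⟨ toℕ-addMod i (a + b) ⟨
    toℕ (addMod i (a + b))             ∎)
    where
    open ≡-Reasoning
    [m%n+k]%n≡[m+k]%n : ∀ x → (x % suc n + b) % suc n ≡ (x + b) % suc n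
    [m%n+k]%n≡[m+k]%n x = begin
      (x % suc n + b) % suc n                ≡⟨ %-distribˡ-+ (x % suc n) b (suc n) ⟩
      (x % suc n % suc n + b % suc n) % suc n ≡⟨ cong (λ r → (r + b % suc n) % suc n) (m%n%n≡m%n x (suc n)) ⟩
      (x % suc n + b % suc n) % suc n        ≡⟨ %-distribˡ-+ x b (suc n) ⟨
      (x + b) % suc n                        ∎

  addMod-size : (i : Fin (suc n)) → addMod i (suc n) ≡ i
  addMod-size i = toℕ-injective (begin
    toℕ (addMod i (suc n))     ≡⟨ toℕ-addMod i (suc n) ⟩
    (toℕ i + suc n) % suc n    ≡⟨ [m+n]%n≡m%n (toℕ i) (suc n) ⟩
    toℕ i % suc n              ≡⟨ m<n⇒m%n≡m (toℕ<n i) ⟩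
    toℕ i                      ∎)
    where open ≡-Reasoning

  -- shift b t is the layer t + b, reading the Boolean b as 0 or 1.
  shift : Bool → Fin (suc n) → Fin (suc n)
  shift false i = i
  shift true  i = addMod i 1

  unshift : Bool → Fin (suc n) → Fin (suc n)
  unshift false i = i
  unshift true  i = addMod i n

  shift-unshift : ∀ b i → shift b (unshift b i) ≡ i
  shift-unshift false i = refl
  shift-unshift true  i = begin
    addMod (addMod i n) 1  ≡⟨ addMod-addMod i n 1 ⟩
    addMod i (n + 1)       ≡⟨ cong (addMod i) (+-comm n 1) ⟩
    addMod i (suc n)       ≡⟨ addMod-size i ⟩
    i                      ∎
    where open ≡-Reasoning

  unshift-shift : ∀ b i → unshift b (shift b i) ≡ i
  unshift-shift false i = refl
  unshift-shift true  i = trans (addMod-addMod i 1 n) (addMod-size i)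

  shift-injective : ∀ b → Injective _≡_ _≡_ (shift b)
  shift-injective b {i} {i'} e =
    trans (sym (unshift-shift b i)) (trans (cong (unshift b) e) (unshift-shift b i'))

  place : {X : Set} → Fin (suc n) → Bool × X → Fin (suc n) × X
  place t p = shift (proj₁ p) t , proj₂ p

EdgeOfFactor-sym : ∀ {V Adj k} (F : CkFactor V Adj k) {u v} → EdgeOfFactor F u v → EdgeOfFactor F v u
EdgeOfFactor-sym F (t , j , inj₁ (p , q)) = t , j , inj₂ (p , q)
EdgeOfFactor-sym F (t , j , inj₂ (p , q)) = t , j , inj₁ (p , q)

disjointCover⇒factorization : ∀ {V Adj k r} (F : Fin r → CkFactor V Adj k) →
  (∀ u v → Adj u v → ∃[ s ] EdgeOfFactor (F s) u v) →
  (∀ s s' {u v} → EdgeOfFactor (F s) u v → EdgeOfFactor (F s') u v → s ≡ s') →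
  CkFactorization V Adj k r
disjointCover⇒factorization F cover disjoint = record
  { factor    = F
  ; partition = λ u v uv → let (s , e) = cover u v uv in s , e , λ s' e' → disjoint s' s e' e
  }

Consecutive : ∀ {A : Set} {k} → (Fin k → A) → A → A → Set
Consecutive f x y = ∃[ j ] (f j ≡ x × f (next j) ≡ y)

consecutive? : ∀ {A : Set} {k} → DecidableEquality A → ∀ (f : Fin k → A) x y → Dec (Consecutive f x y)
consecutive? _≟ᴬ_ f x y = any? λ j → (f j ≟ᴬ x) ×-dec (f (next j) ≟ᴬ y)

module TranslatedFactor
  {X : Set} {n k : ℕ} {Adj : Fin (suc n) × X → Fin (suc n) × X → Set}
  (τ : Fin k → Bool × X)
  (coord-injective : Injective _≡_ _≡_ (proj₂ ∘ τ))
  (coord-surjective : ∀ x → ∃[ j ] proj₂ (τ j) ≡ x)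
  (adjacent : ∀ t j → Adj (place t (τ j)) (place t (τ (next j))))
  where

  translate : Fin (suc n) → Cycle (Fin (suc n) × X) Adj k
  translate t = record
    { vtx      = λ j → place t (τ j)
    ; distinct = coord-injective ∘ cong proj₂
    ; adjacent = adjacent t
    }

  translates-cover : ∀ v → ∃[ t ] ∃[ j ] place {n} t (τ j) ≡ v
  translates-cover (i , x) with coord-surjective x
  ... | j , refl = unshift (proj₁ (τ j)) i , j , cong (_, proj₂ (τ j)) (shift-unshift (proj₁ (τ j)) i)

  translates-disjoint : ∀ (t t' : Fin (suc n)) j j' → place t (τ j) ≡ place t' (τ j') → t ≡ t'
  translates-disjoint t t' j j' e with coord-injective (cong proj₂ e)
  ... | refl = shift-injective (proj₁ (τ j)) (cong proj₁ e)

  factor : CkFactor (Fin (suc n) × X) Adj k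
  factor = record
    { numCycles = suc n
    ; cycle     = translate
    ; cover     = translates-cover
    ; disjoint  = translates-disjoint
    }

  step-edge : ∀ t j → EdgeOfFactor factor (place t (τ j)) (place t (τ (next j)))
  step-edge t j = t , j , inj₁ (refl , refl)

  layer-edge : ∀ j → proj₁ (τ j) ≡ proj₁ (τ (next j)) → ∀ i →
               EdgeOfFactor factor (i , proj₂ (τ j)) (i , proj₂ (τ (next j)))
  layer-edge j same i =
    t , j , inj₁ (cong (_, _) back , cong (_, _) (subst (λ c → shift c t ≡ i) same back))
    where
    t = unshift (proj₁ (τ j)) i
    back : shift (proj₁ (τ j)) t ≡ i
    back = shift-unshift (proj₁ (τ j)) i

  edge⇒consecutive : ∀ {u v} → EdgeOfFactor factor u v →
    Consecutive (proj₂ ∘ τ) (proj₂ u) (proj₂ v) ⊎ Consecutive (proj₂ ∘ τ) (proj₂ v) (proj₂ u)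
  edge⇒consecutive (_ , j , inj₁ (refl , refl)) = inj₁ (j , refl , refl)
  edge⇒consecutive (_ , j , inj₂ (refl , refl)) = inj₂ (j , refl , refl)

-- Position j of cycle t of factor s is the vertex (t + b , x) for (b , x) = template s j.
template : Fin 2 → Fin 8 → Bool × Fin 8
template 0F 0F = false , 0F
template 0F 1F = true  , 6F
template 0F 2F = true  , 5F
template 0F 3F = false , 7F
template 0F 4F = false , 4F
template 0F 5F = true  , 2F
template 0F 6F = true  , 1F
template 0F 7F = false , 3F
template 1F 0F = true  , 0F
template 1F 1F = false , 2F
template 1F 2F = false , 5F
template 1F 3F = true  , 3F
template 1F 4F = true  , 4F
template 1F 5F = false , 6F
template 1F 6F = false , 1F
template 1F 7F = true  , 7F

coord : Fin 2 → Fin 8 → Fin 8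
coord s = proj₂ ∘ template s

template-adjacent : ∀ {n} s (t : Fin (suc n)) j →
                    AdjG (suc n) (place t (template s j)) (place t (template s (next j)))
template-adjacent 0F t 0F = inj₁ (refl , refl)
template-adjacent 0F t 1F = inj₂ (inj₂ (refl , p65))
template-adjacent 0F t 2F = inj₂ (inj₁ (refl , refl))
template-adjacent 0F t 3F = inj₂ (inj₂ (refl , p74))
template-adjacent 0F t 4F = inj₁ (refl , refl)
template-adjacent 0F t 5F = inj₂ (inj₂ (refl , p21))
template-adjacent 0F t 6F = inj₂ (inj₁ (refl , refl))
template-adjacent 0F t 7F = inj₂ (inj₂ (refl , p30))
template-adjacent 1F t 0F = inj₂ (inj₁ (refl , refl))
template-adjacent 1F t 1F = inj₂ (inj₂ (refl , p25))
template-adjacent 1F t 2F = inj₁ (refl , refl)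
template-adjacent 1F t 3F = inj₂ (inj₂ (refl , p34))
template-adjacent 1F t 4F = inj₂ (inj₁ (refl , refl))
template-adjacent 1F t 5F = inj₂ (inj₂ (refl , p61))
template-adjacent 1F t 6F = inj₁ (refl , refl)
template-adjacent 1F t 7F = inj₂ (inj₂ (refl , p70))

coord-injective : ∀ s → Injective _≡_ _≡_ (coord s)
coord-injective s {j} {j'} = from-yes
  (all? λ s → all? λ j → all? λ j' → (coord s j ≟ coord s j') →-dec (j ≟ j')) s j j'

coord-surjective : ∀ s x → ∃[ j ] coord s j ≡ x
coord-surjective = from-yes (all? λ s → all? λ x → any? λ j → coord s j ≟ x)

coord-cycles-edge-disjoint : ∀ x y →
  ¬ ((Consecutive (coord 0F) x y ⊎ Consecutive (coord 0F) y x) ×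
     (Consecutive (coord 1F) x y ⊎ Consecutive (coord 1F) y x))
coord-cycles-edge-disjoint = from-yes (all? λ x → all? λ y → ¬? (link? 0F x y ×-dec link? 1F x y))
  where
  link? : ∀ s x y → Dec (Consecutive (coord s) x y ⊎ Consecutive (coord s) y x)
  link? s x y = consecutive? _≟_ (coord s) x y ⊎-dec consecutive? _≟_ (coord s) y x

module _ (n : ℕ) where

  module T (s : Fin 2) =
    TranslatedFactor {n = n} {Adj = AdjG (suc n)}
      (template s) (coord-injective s) (coord-surjective s) (template-adjacent s)
  open T using (factor)

  cross-edge-covered : ∀ i x → ∃[ s ] EdgeOfFactor (factor s) (i , x) (addMod i 1 , addMod x 6)
  cross-edge-covered i 0F = 0F , T.step-edge 0F i 0F
  cross-edge-covered i 1F = 1F , T.step-edge 1F i 6F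
  cross-edge-covered i 2F = 1F , EdgeOfFactor-sym (factor 1F) (T.step-edge 1F i 0F)
  cross-edge-covered i 3F = 0F , EdgeOfFactor-sym (factor 0F) (T.step-edge 0F i 6F)
  cross-edge-covered i 4F = 0F , T.step-edge 0F i 4F
  cross-edge-covered i 5F = 1F , T.step-edge 1F i 2F
  cross-edge-covered i 6F = 1F , EdgeOfFactor-sym (factor 1F) (T.step-edge 1F i 4F)
  cross-edge-covered i 7F = 0F , EdgeOfFactor-sym (factor 0F) (T.step-edge 0F i 2F)

  layer-edge-covered : ∀ i {x y} → I₂∪I₇ x y → ∃[ s ] EdgeOfFactor (factor s) (i , x) (i , y)
  layer-edge-covered i p12 = 0F , EdgeOfFactor-sym (factor 0F) (T.layer-edge 0F 5F refl i)
  layer-edge-covered i p21 = 0F , T.layer-edge 0F 5F refl i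
  layer-edge-covered i p34 = 1F , T.layer-edge 1F 3F refl i
  layer-edge-covered i p43 = 1F , EdgeOfFactor-sym (factor 1F) (T.layer-edge 1F 3F refl i)
  layer-edge-covered i p56 = 0F , EdgeOfFactor-sym (factor 0F) (T.layer-edge 0F 1F refl i)
  layer-edge-covered i p65 = 0F , T.layer-edge 0F 1F refl i
  layer-edge-covered i p70 = 1F , T.layer-edge 1F 7F refl i
  layer-edge-covered i p07 = 1F , EdgeOfFactor-sym (factor 1F) (T.layer-edge 1F 7F refl i)
  layer-edge-covered i p03 = 0F , EdgeOfFactor-sym (factor 0F) (T.layer-edge 0F 7F refl i)
  layer-edge-covered i p30 = 0F , T.layer-edge 0F 7F refl i
  layer-edge-covered i p16 = 1F , EdgeOfFactor-sym (factor 1F) (T.layer-edge 1F 5F refl i)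
  layer-edge-covered i p61 = 1F , T.layer-edge 1F 5F refl i
  layer-edge-covered i p25 = 1F , T.layer-edge 1F 1F refl i
  layer-edge-covered i p52 = 1F , EdgeOfFactor-sym (factor 1F) (T.layer-edge 1F 1F refl i)
  layer-edge-covered i p47 = 0F , EdgeOfFactor-sym (factor 0F) (T.layer-edge 0F 3F refl i)
  layer-edge-covered i p74 = 0F , T.layer-edge 0F 3F refl i

  edge-covered : ∀ u v → AdjG (suc n) u v → ∃[ s ] EdgeOfFactor (factor s) u v
  edge-covered (i , x) _ (inj₁ (refl , refl)) = cross-edge-covered i x
  edge-covered _ (i , x) (inj₂ (inj₁ (refl , refl))) =
    let (s , e) = cross-edge-covered i x in s , EdgeOfFactor-sym (factor s) e
  edge-covered (i , _) _ (inj₂ (inj₂ (refl , xy))) = layer-edge-covered i xy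

  factors-edge-disjoint : ∀ s s' {u v} →
    EdgeOfFactor (factor s) u v → EdgeOfFactor (factor s') u v → s ≡ s'
  factors-edge-disjoint 0F 0F _ _  = refl
  factors-edge-disjoint 1F 1F _ _  = refl
  factors-edge-disjoint 0F 1F e e' =
    ⊥-elim (coord-cycles-edge-disjoint _ _ (T.edge⇒consecutive 0F e , T.edge⇒consecutive 1F e'))
  factors-edge-disjoint 1F 0F e e' =
    ⊥-elim (coord-cycles-edge-disjoint _ _ (T.edge⇒consecutive 0F e' , T.edge⇒consecutive 1F e))

  zigzag-factorization : CkFactorization (Vertex (suc n)) (AdjG (suc n)) 8 2
  zigzag-factorization = disjointCover⇒factorization factor edge-covered factors-edge-disjoint

-- The hypothesis only rules out m = 0; the construction works for every m ≥ 1.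
lemma2p12 : (m : ℕ) → 3 ≤ m → CkFactorization (Vertex m) (AdjG m) 8 2
lemma2p12 (suc n) _ = zigzag-factorization n
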